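{- For the wheel graphs $W_{1,n} = C_n + K_1$, one has $\dim(L(W_{1,3})) = \dim(L(W_{1,4})) = 3$ and $\dim(L(W_{1,5})) = 4$.
   Context: All graphs are finite, simple, undirected and connected. For a graph $H$, a set $W \subseteq V(H)$ is a resolving set if for every pair of distinct vertices $u,v$ there is $x \in W$ with $d(u,x) \ne d(v,x)$ ($d$ the shortest-path distance); $\dim(H)$ is the minimum cardinality of a resolving set. $L(G)$ is the line graph of $G$ (vertices are the edges of $G$, adjacent iff they share an endpoint). $W_{1,n} = C_n + K_1$ is the join of the cycle $C_n$ with one extra vertex adjacent to all vertices of $C_n$. -}

module Defs where

open import Data.Nat using (ℕ; zero; suc; _≤_; _≡ᵇ_)
open import Data.Bool using (Bool; true; false; _∨_; _∧_; T)
open import Data.Fin using (Fin; zero; suc; toℕ; _<_)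
open import Data.Product using (Σ; Σ-syntax; ∃; ∃-syntax; _×_; _,_; proj₁; proj₂)
open import Data.Sum using (_⊎_)
open import Data.List using (List; length)
open import Data.List.Membership.Propositional using (_∈_)
open import Data.List.Relation.Unary.Unique.Propositional using (Unique)
open import Relation.Binary.PropositionalEquality using (_≡_; _≢_)

record Graph : Set₁ where
  field
    Vertex : Set
    Adj    : Vertex → Vertex → Set
open Graph public

data Walk (G : Graph) : Vertex G → Vertex G → ℕ → Set where
  nil  : ∀ {u} → Walk G u u 0
  cons : ∀ {u w v k} → Adj G u w → Walk G w v k → Walk G u v (suc k)

Dist : (G : Graph) → Vertex G → Vertex G → ℕ → Set
Dist G u v k = Walk G u v k × (∀ j → Walk G u v j → k ≤ j)

Resolving : (G : Graph) → List (Vertex G) → Set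
Resolving G W = ∀ u v → u ≢ v →
  ∃[ x ] (x ∈ W × ∃[ k₁ ] ∃[ k₂ ] (Dist G u x k₁ × Dist G v x k₂ × k₁ ≢ k₂))

MetricDim : Graph → ℕ → Set
MetricDim G m =
  (Σ[ W ∈ List (Vertex G) ] (Unique W × length W ≡ m × Resolving G W))
  × (∀ (W : List (Vertex G)) → Unique W → Resolving G W → m ≤ length W)

-- A simple graph on vertex set Fin n given by a Boolean adjacency function.
-- Its line graph: vertices are edges {a,b} represented as (a,b) with a < b
-- and adj a b; two distinct edges are adjacent iff they share an endpoint.
LineGraph : (n : ℕ) → (Fin n → Fin n → Bool) → Graph
LineGraph n adj = record
  { Vertex = Σ[ p ∈ (Fin n × Fin n) ] (proj₁ p < proj₂ p × T (adj (proj₁ p) (proj₂ p)))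
  ; Adj    = λ e f → e ≢ f × share (proj₁ e) (proj₁ f)
  }
  where
  share : Fin n × Fin n → Fin n × Fin n → Set
  share (a , b) (c , d) = (a ≡ c) ⊎ (a ≡ d) ⊎ (b ≡ c) ⊎ (b ≡ d)

-- Adjacency of the cycle C_n on {0,…,n-1}: i ~ i+1 (mod n).
cycAdj : ℕ → ℕ → ℕ → Bool
cycAdj n a b = (suc a ≡ᵇ b) ∨ (suc b ≡ᵇ a)
             ∨ ((a ≡ᵇ 0) ∧ (suc b ≡ᵇ n)) ∨ ((b ≡ᵇ 0) ∧ (suc a ≡ᵇ n))

-- Wheel W_{1,n} = C_n + K_1 on Fin (suc n): vertex zero is the hub,
-- vertices suc i (i : Fin n) form the cycle C_n.
wheelAdj : (n : ℕ) → Fin (suc n) → Fin (suc n) → Bool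
wheelAdj n zero    zero    = false
wheelAdj n zero    (suc j) = true
wheelAdj n (suc i) zero    = true
wheelAdj n (suc i) (suc j) = cycAdj n (toℕ i) (toℕ j)

LineWheel : ℕ → Graph
LineWheel n = LineGraph (suc n) (wheelAdj n)

-- For n ≤ 5 any two distinct, non-adjacent edges of the wheel W_{1,n} both meet a third edge,
-- so L(W_{1,n}) has diameter at most 2 and the distance between two of its vertices is 0, 1
-- or 2 according to equality and adjacency. Resolvability thus becomes a decidable property of
-- finite lists of edges, and both bounds follow by exhaustive search: the spokes to three
-- (resp. three, four) rim vertices resolve L(W_{1,n}), and no shorter list of edges does.
module Submission where

open import Defs
open import Data.Bool using (Bool; T)
open import Data.Bool.Properties using (T-irrelevant)
open import Data.Empty using (⊥-elim)
open import Data.Fin using (Fin; zero; suc; #_) renaming (_<_ to _<ᶠ_)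
open import Data.Fin.Properties using (<-irrelevant) renaming (_≟_ to _≟ᶠ_; _<?_ to _<ᶠ?_)
open import Data.List using (List; []; _∷_; length; map; allFin; cartesianProduct)
open import Data.List.Membership.Propositional using (_∈_; find; lose)
open import Data.List.Membership.Propositional.Properties using (∈-allFin; ∈-cartesianProduct⁺)
import Data.List.Relation.Unary.All as All
open import Data.List.Relation.Unary.Any as Any using (Any; here; there)
open import Data.List.Relation.Unary.Unique.Propositional using (Unique)
import Data.List.Relation.Unary.Unique.DecPropositional as UniqueDec
open import Data.Nat using (ℕ; zero; suc; _≤_; _<_; z≤n; s≤s)
open import Data.Nat.Properties using (≤-antisym; ≮⇒≥) renaming (_≟_ to _≟ⁿ_)
open import Data.Product using (Σ; ∃-syntax; _×_; _,_; proj₁)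
open import Data.Product.Properties using (≡-dec)
open import Data.Unit using (tt)
open import Function using (_∘′_)
open import Relation.Binary using (DecidableEquality) renaming (Decidable to Decidable₂)
open import Relation.Binary.PropositionalEquality using (_≡_; _≢_; refl; sym; trans; cong; cong₂)
open import Relation.Nullary using (¬_; Dec; yes; no; ¬?)
open import Relation.Nullary.Decidable using (True; toWitness; map′; _×-dec_; _⊎-dec_; _→-dec_; T?)
open import Relation.Unary using (Decidable)

metricDim-intro : ∀ {G} (W : List (Vertex G)) → Unique W → Resolving G W →
                  (∀ W′ → length W′ < length W → ¬ Resolving G W′) → MetricDim G (length W)
metricDim-intro W unique resolving minimal =
  (W , unique , refl , resolving) , λ W′ _ resolving′ → ≮⇒≥ λ shorter → minimal W′ shorter resolving′

module Enumeration {A : Set} (xs : List A) (complete : ∀ x → x ∈ xs) where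

  all? : {P : A → Set} → Decidable P → Dec (∀ x → P x)
  all? P? = map′ (λ all x → All.lookup all (complete x)) (λ f → All.tabulate (λ {x} _ → f x))
                 (All.all? P? xs)

  any? : {P : A → Set} → Decidable P → Dec (∃[ x ] P x)
  any? P? = map′ Any.satisfied (λ (x , px) → lose (complete x) px) (Any.any? P? xs)

  all-shorter? : ∀ m {P : List A → Set} → Decidable P → Dec (∀ ys → length ys < m → P ys)
  all-shorter? zero    P? = yes λ _ ()
  all-shorter? (suc m) P? =
    map′ (λ (p[] , p∷) → λ { [] _ → p[] ; (y ∷ ys) (s≤s l) → p∷ y ys l })
         (λ p → p [] (s≤s z≤n) , λ y ys l → p (y ∷ ys) (s≤s l))
         (P? [] ×-dec all? (λ y → all-shorter? m (λ ys → P? (y ∷ ys))))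

Diameter≤2 : Graph → Set
Diameter≤2 G = ∀ u v → u ≢ v → ¬ Adj G u v → ∃[ w ] (Adj G u w × Adj G w v)

module FiniteGraph (G : Graph) (_≟_ : DecidableEquality (Vertex G)) (adj? : Decidable₂ (Adj G))
                   (vertices : List (Vertex G)) (∈-vertices : ∀ v → v ∈ vertices) where

  open Enumeration vertices ∈-vertices public

  diameter≤2? : Dec (Diameter≤2 G)
  diameter≤2? = all? λ u → all? λ v → ¬? (u ≟ v) →-dec ¬? (adj? u v) →-dec
                  any? λ w → adj? u w ×-dec adj? w v

  dist : Vertex G → Vertex G → ℕ
  dist u v with u ≟ v | adj? u v
  ... | yes _ | _     = 0
  ... | no _  | yes _ = 1
  ... | no _  | no _  = 2

  dist≤length : ∀ {u v j} → Walk G u v j → dist u v ≤ j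
  dist≤length {u} {v} w with u ≟ v | adj? u v | w
  ... | yes _   | _     | _                 = z≤n
  ... | no u≢v  | _     | nil               = ⊥-elim (u≢v refl)
  ... | no _    | yes _ | cons _ _          = s≤s z≤n
  ... | no _    | no ¬a | cons a nil        = ⊥-elim (¬a a)
  ... | no _    | no _  | cons _ (cons _ _) = s≤s (s≤s z≤n)

  Separates : List (Vertex G) → Set
  Separates W = ∀ u v → u ≢ v → Any (λ x → dist u x ≢ dist v x) W

  separates? : Decidable Separates
  separates? W = all? λ u → all? λ v → ¬? (u ≟ v) →-dec Any.any? (λ x → ¬? (dist u x ≟ⁿ dist v x)) W

  module _ (diameter≤2 : Diameter≤2 G) where

    shortest-walk : ∀ u v → Walk G u v (dist u v)
    shortest-walk u v with u ≟ v | adj? u v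
    ... | yes refl | _     = nil
    ... | no _     | yes a = cons a nil
    ... | no u≢v   | no ¬a = let _ , a₁ , a₂ = diameter≤2 u v u≢v ¬a in cons a₁ (cons a₂ nil)

    Dist-dist : ∀ u v → Dist G u v (dist u v)
    Dist-dist u v = shortest-walk u v , λ _ → dist≤length

    Dist⇒≡dist : ∀ {u v k} → Dist G u v k → k ≡ dist u v
    Dist⇒≡dist {u} {v} (w , minimal) = ≤-antisym (minimal _ (shortest-walk u v)) (dist≤length w)

    separates⇒resolving : ∀ W → Separates W → Resolving G W
    separates⇒resolving W separates u v u≢v =
      let x , x∈W , d≢ = find (separates u v u≢v)
      in x , x∈W , _ , _ , Dist-dist u x , Dist-dist v x , d≢

    resolving⇒separates : ∀ W → Resolving G W → Separates W
    resolving⇒separates W resolving u v u≢v =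
      let x , x∈W , _ , _ , d₁ , d₂ , k≢ = resolving u v u≢v
      in lose x∈W λ e → k≢ (trans (Dist⇒≡dist d₁) (trans e (sym (Dist⇒≡dist d₂))))

    metricDim-by-search : (W : List (Vertex G)) → Unique W → Separates W →
                          (∀ W′ → length W′ < length W → ¬ Separates W′) → MetricDim G (length W)
    metricDim-by-search W unique separates minimal =
      metricDim-intro W unique (separates⇒resolving W separates)
        λ W′ shorter → minimal W′ shorter ∘′ resolving⇒separates W′

module _ {A : Set} {P : A → Set} (P? : Decidable P) (P-irrelevant : ∀ {x} (p q : P x) → p ≡ q) where

  filterΣ : List A → List (Σ A P)
  filterΣ []       = []
  filterΣ (x ∷ xs) with P? x
  ... | yes px = (x , px) ∷ filterΣ xs
  ... | no _   = filterΣ xs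

  ∈-filterΣ : ∀ {x xs} → x ∈ xs → (px : P x) → (x , px) ∈ filterΣ xs
  ∈-filterΣ {x} {x ∷ xs} (here refl) px with P? x
  ... | yes px′ = here (cong (x ,_) (P-irrelevant px px′))
  ... | no ¬px  = ⊥-elim (¬px px)
  ∈-filterΣ {x} {y ∷ xs} (there x∈xs) px with P? y
  ... | yes _ = there (∈-filterΣ x∈xs px)
  ... | no _  = ∈-filterΣ x∈xs px

module FiniteLineGraph (n : ℕ) (adj : Fin n → Fin n → Bool) where

  private
    G : Graph
    G = LineGraph n adj

  IsEdge : Fin n × Fin n → Set
  IsEdge (a , b) = a <ᶠ b × T (adj a b)

  isEdge? : Decidable IsEdge
  isEdge? (a , b) = a <ᶠ? b ×-dec T? (adj a b)

  isEdge-irrelevant : ∀ {e} (p q : IsEdge e) → p ≡ q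
  isEdge-irrelevant (l , t) (l′ , t′) = cong₂ _,_ (<-irrelevant l l′) (T-irrelevant t t′)

  _≟ₑ_ : DecidableEquality (Vertex G)
  e ≟ₑ f = map′ (λ { refl → cong (proj₁ e ,_) (isEdge-irrelevant _ _) }) (cong proj₁)
                (≡-dec _≟ᶠ_ _≟ᶠ_ (proj₁ e) (proj₁ f))

  adjacent? : Decidable₂ (Adj G)
  adjacent? e@((a , b) , _) f@((c , d) , _) =
    ¬? (e ≟ₑ f) ×-dec (a ≟ᶠ c ⊎-dec a ≟ᶠ d ⊎-dec b ≟ᶠ c ⊎-dec b ≟ᶠ d)

  edges : List (Vertex G)
  edges = filterΣ isEdge? isEdge-irrelevant (cartesianProduct (allFin n) (allFin n))

  ∈-edges : ∀ e → e ∈ edges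
  ∈-edges ((a , b) , p) =
    ∈-filterΣ isEdge? isEdge-irrelevant (∈-cartesianProduct⁺ (∈-allFin a) (∈-allFin b)) p

  open FiniteGraph G _≟ₑ_ adjacent? edges ∈-edges public
  open UniqueDec _≟ₑ_ public using (unique?)

spoke : ∀ {n} → Fin n → Vertex (LineWheel n)
spoke i = (zero , suc i) , s≤s z≤n , tt

lineWheel-metricDim : ∀ n (W : List (Vertex (LineWheel n))) → let open FiniteLineGraph (suc n) (wheelAdj n) in
  {diameter : True diameter≤2?} {unique : True (unique? W)} {separates : True (separates? W)}
  {minimal : True (all-shorter? (length W) (λ W′ → ¬? (separates? W′)))} →
  MetricDim (LineWheel n) (length W)
lineWheel-metricDim n W {diameter} {unique} {separates} {minimal} =
  metricDim-by-search (toWitness diameter) W (toWitness unique) (toWitness separates) (toWitness minimal)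
  where open FiniteLineGraph (suc n) (wheelAdj n)

proposition2p10 : MetricDim (LineWheel 3) 3 × MetricDim (LineWheel 4) 3 × MetricDim (LineWheel 5) 4
proposition2p10 =
    lineWheel-metricDim 3 (map spoke (# 0 ∷ # 1 ∷ # 2 ∷ []))
  , lineWheel-metricDim 4 (map spoke (# 0 ∷ # 1 ∷ # 2 ∷ []))
  , lineWheel-metricDim 5 (map spoke (# 0 ∷ # 1 ∷ # 2 ∷ # 3 ∷ []))
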